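{- If $p$ is a position of $\mathsf{G}$, then in the delayed gamegraph $\mathsf{G}\sqcap\mathsf{D}_k$ we have $\text{nim}(p,2r)=\text{nim}(p,0)=\text{nim}(p)$ and $\text{nim}(p,2r+1)=\text{nim}(p,1)$, where $\text{nim}$ denotes the Sprague–Grundy value.
   Context: A gamegraph $\mathsf{G}$ is a finite set of positions with an option function $\text{Opt}:\mathsf{G}\to 2^{\mathsf{G}}$ (the set of positions reachable in one move), having only acyclic plays and a starting position of which every position is a subposition; a position is terminal if it has no options. $\mathsf{D}_k$ is the directed path with positions $k,k-1,\dots,0$, $\text{Opt}(i)=\{i-1\}$ for $1\le i\le k$ and $\text{Opt}(0)=\emptyset$. The delayed gamegraph $\mathsf{G}\sqcap\mathsf{D}_k$ has positions $\mathsf{G}\times\mathsf{D}_k$, where $(q,r)\in\text{Opt}(p,r)$ iff $q\in\text{Opt}(p)$, and $(p,s)\in\text{Opt}(p,r)$ iff $s\in\text{Opt}(r)$ and $p$ is not terminal in $\mathsf{G}$ (i.e. the disjunctive sum $\mathsf{G}\Box\mathsf{D}_k$ with the moves in $\mathsf{D}_k$ from terminal positions of $\mathsf{G}$ removed). Here $2r$ and $2r+1$ range over positions of $\mathsf{D}_k$. -}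

module Defs where

open import Data.Nat using (ℕ; zero; suc; _<_)
open import Data.Nat.Properties using (_≟_)
open import Data.Fin using (Fin; zero; suc; inject₁; toℕ)
open import Data.Fin.Properties using (toℕ-inject₁)
open import Data.Bool using (if_then_else_)
open import Data.Product using (_×_; _,_; proj₁; proj₂)
open import Data.List using (List; []; _∷_; _++_; map; length)
open import Data.List.Membership.Propositional using (_∈_; mapWith∈)
open import Data.List.Membership.Propositional.Properties using (∈-++⁻; ∈-map⁻)
open import Data.List.Membership.DecPropositional _≟_ using (_∈?_)
open import Data.List.Relation.Unary.Any using (here; there)
open import Data.Sum using (inj₁; inj₂)
open import Relation.Nullary using (does)
open import Relation.Binary.PropositionalEquality using (_≡_; refl; sym; trans; cong)
open import Relation.Binary.Construct.Closure.ReflexiveTransitive using (Star)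
open import Induction.WellFounded using (WellFounded; Acc; acc)

-- "q is an option of p" for an option function given as a list of options
-- (2^G is represented by lists; repetitions are irrelevant)
OptRel : {A : Set} → (A → List A) → A → A → Set
OptRel Opt q p = q ∈ Opt p

record Gamegraph : Set₁ where
  field
    Pos       : Set
    positions : List Pos
    finite    : ∀ p → p ∈ positions
    Opt       : Pos → List Pos
    acyclic   : WellFounded (OptRel Opt)
    start     : Pos
    reachable : ∀ p → Star (λ a b → b ∈ Opt a) start p

-- minimum excludant of a finite set of naturals:
-- the least m with m ∉ xs (it is at most length xs)
mexFrom : ℕ → ℕ → List ℕ → ℕ
mexFrom m zero       xs = m
mexFrom m (suc fuel) xs = if does (m ∈? xs) then mexFrom (suc m) fuel xs else m

mex : List ℕ → ℕ
mex xs = mexFrom 0 (length xs) xs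

nimAcc : {A : Set} (Opt : A → List A) (p : A) → Acc (OptRel Opt) p → ℕ
nimAcc Opt p (acc rs) = mex (mapWith∈ (Opt p) (λ {q} q∈ → nimAcc Opt q (rs q∈)))

nimWF : {A : Set} (Opt : A → List A) → WellFounded (OptRel Opt) → A → ℕ
nimWF Opt wf p = nimAcc Opt p (wf p)

nim : (G : Gamegraph) → Gamegraph.Pos G → ℕ
nim G = nimWF (Gamegraph.Opt G) (Gamegraph.acyclic G)

-- The directed path D_k: positions k, k-1, …, 0 (as Fin (suc k)),
-- Opt(i) = {i-1} for i ≥ 1, Opt(0) = ∅.
DOpt : ∀ {k} → Fin (suc k) → List (Fin (suc k))
DOpt zero    = []
DOpt (suc s) = inject₁ s ∷ []

-- moves in the second component are only allowed when the first component
-- is not terminal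
unlessTerminal : {A B : Set} → List A → List B → List B
unlessTerminal []      ys = []
unlessTerminal (_ ∷ _) ys = ys

DelayedOpt : (G : Gamegraph) (k : ℕ) → Gamegraph.Pos G × Fin (suc k) → List (Gamegraph.Pos G × Fin (suc k))
DelayedOpt G k (p , r) =
  map (λ q → (q , r)) (Gamegraph.Opt G p) ++
  unlessTerminal (Gamegraph.Opt G p) (map (λ s → (p , s)) (DOpt r))

private
  unless-∈ : {A B : Set} (xs : List A) (ys : List B) {y : B} → y ∈ unlessTerminal xs ys → y ∈ ys
  unless-∈ []      ys ()
  unless-∈ (_ ∷ _) ys y∈ = y∈

  module _ (G : Gamegraph) (k : ℕ) where
    open Gamegraph G

    accD : ∀ p → Acc (OptRel Opt) p → ∀ (m : ℕ) (r : Fin (suc k)) → toℕ r ≡ m →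
           Acc (OptRel (DelayedOpt G k)) (p , r)
    accD p (acc rsp) m r eq = acc step
      where
      step : ∀ {y} → y ∈ DelayedOpt G k (p , r) → Acc (OptRel (DelayedOpt G k)) y
      step y∈ with ∈-++⁻ (map (λ q → (q , r)) (Opt p)) y∈
      ... | inj₁ y∈₁ with ∈-map⁻ (λ q → (q , r)) y∈₁
      ...   | q , q∈ , refl = accD q (rsp q∈) m r eq
      step y∈ | inj₂ y∈₂ with ∈-map⁻ (λ s → (p , s)) (unless-∈ (Opt p) _ y∈₂)
      step y∈ | inj₂ y∈₂ | s , s∈ , refl = go r eq s s∈
        where
        go : ∀ r → toℕ r ≡ m → ∀ s → s ∈ DOpt r → Acc (OptRel (DelayedOpt G k)) (p , s)
        go zero    eq s ()
        go (suc t) refl .(inject₁ t) (here refl) =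
          accD p (acc rsp) (toℕ t) (inject₁ t) (toℕ-inject₁ t)

  delayedWF : (G : Gamegraph) (k : ℕ) → WellFounded (OptRel (DelayedOpt G k))
  delayedWF G k (p , r) = accD G k p (Gamegraph.acyclic G p) (toℕ r) r refl

nimDelayed : (G : Gamegraph) (k : ℕ) → Gamegraph.Pos G × Fin (suc k) → ℕ
nimDelayed G k = nimWF (DelayedOpt G k) (delayedWF G k)

module Submission where

open import Defs
open import Data.Nat using (ℕ; zero; suc; _+_; _*_; _<_)
open import Data.Nat.Properties using (_≟_; <-irrefl; <-cmp; m<1+n⇒m<n∨m≡n; n<1+n; +-suc; +-identityʳ; *-suc; suc-injective)
open import Data.Fin using (Fin; zero; suc; toℕ; fromℕ<; pred)
open import Data.Fin.Properties using (toℕ<n; toℕ-injective; toℕ-fromℕ<; toℕ-inject₁; pigeonhole)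
open import Data.Product using (_×_; _,_; ∃)
open import Data.Sum using (inj₁; inj₂)
open import Data.Empty using (⊥-elim)
open import Data.List using (List; []; _∷_; [_]; _++_; map; length; lookup)
open import Data.List.Properties using (map-++; map-∘; map-cong-local; ++-identityʳ)
open import Data.List.Membership.Propositional using (_∈_; _∉_; mapWith∈)
open import Data.List.Membership.Propositional.Properties using (mapWith∈-cong; mapWith∈≗map; ∈-++⁺ˡ; ∈-++⁺ʳ; ∈-++⁻)
open import Data.List.Membership.DecPropositional _≟_ using (_∈?_)
open import Data.List.Relation.Unary.All as All using ()
open import Data.List.Relation.Unary.Any using (here; index)
open import Data.List.Relation.Unary.Any.Properties using (lookup-index)
open import Relation.Nullary using (yes; no; ¬_)
open import Relation.Binary.Definitions using (tri<; tri≈; tri>)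
open import Relation.Binary.PropositionalEquality using (_≡_; _≢_; refl; sym; trans; cong; cong₂; subst; module ≡-Reasoning)
open import Induction.WellFounded using (WellFounded; Acc; acc)

-- In G ⊓ D_k a non-terminal p gains exactly one option, (p, r) → (p, r - 1).
-- At r = 0 it is absent, so nim(p, 0) = nim(p) by induction on p. At r = 2
-- the extra option has value nim(p, 1), which differs from nim(p, 0) because
-- (p, 0) is an option of (p, 1); adding a value other than the mex leaves the
-- mex unchanged, so nim(p, 2) = nim(p, 0). For r ≥ 3 the option values of
-- (p, r) and (p, r - 2) coincide: those of the G-moves by induction on p, and
-- nim(p, r - 1) = nim(p, r - 3) by induction on r.

Covers : List ℕ → ℕ → Set
Covers xs m = ∀ {j} → j < m → j ∈ xs

Covers-suc : ∀ {xs m} → Covers xs m → m ∈ xs → Covers xs (suc m)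
Covers-suc cov m∈ j<1+m with m<1+n⇒m<n∨m≡n j<1+m
... | inj₁ j<m  = cov j<m
... | inj₂ refl = m∈

¬Covers-1+length : ∀ xs → ¬ Covers xs (suc (length xs))
¬Covers-1+length xs cov with pigeonhole (n<1+n (length xs)) position
  where
  position : Fin (suc (length xs)) → Fin (length xs)
  position i = index (cov (toℕ<n i))
... | i , j , i<j , same = <-irrefl toℕi≡toℕj i<j
  where
  toℕi≡toℕj : toℕ i ≡ toℕ j
  toℕi≡toℕj = begin
    toℕ i                                 ≡⟨ lookup-index (cov (toℕ<n i)) ⟩
    lookup xs (index (cov (toℕ<n i)))     ≡⟨ cong (lookup xs) same ⟩
    lookup xs (index (cov (toℕ<n j)))     ≡⟨ lookup-index (cov (toℕ<n j)) ⟨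
    toℕ j                                 ∎
    where open ≡-Reasoning

mexFrom-covers : ∀ xs m fuel → Covers xs m → Covers xs (mexFrom m fuel xs)
mexFrom-covers xs m zero       cov = cov
mexFrom-covers xs m (suc fuel) cov with m ∈? xs
... | yes m∈ = mexFrom-covers xs (suc m) fuel (Covers-suc cov m∈)
... | no  _  = cov

mexFrom-∉ : ∀ xs m fuel → Covers xs m → m + fuel ≡ length xs → mexFrom m fuel xs ∉ xs
mexFrom-∉ xs m zero cov m+0≡ m∈ =
  ¬Covers-1+length xs (subst (λ n → Covers xs (suc n)) (trans (sym (+-identityʳ m)) m+0≡) (Covers-suc cov m∈))
mexFrom-∉ xs m (suc fuel) cov m+1+fuel≡ with m ∈? xs
... | yes m∈ = mexFrom-∉ xs (suc m) fuel (Covers-suc cov m∈) (trans (sym (+-suc m fuel)) m+1+fuel≡)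
... | no  m∉ = m∉

mex-covers : ∀ xs → Covers xs (mex xs)
mex-covers xs = mexFrom-covers xs 0 (length xs) λ ()

mex-∉ : ∀ xs → mex xs ∉ xs
mex-∉ xs = mexFrom-∉ xs 0 (length xs) (λ ()) refl

mex-unique : ∀ {xs m} → m ∉ xs → Covers xs m → mex xs ≡ m
mex-unique {xs} {m} m∉ cov with <-cmp (mex xs) m
... | tri< mex<m _ _ = ⊥-elim (mex-∉ xs (cov mex<m))
... | tri≈ _ mex≡m _ = mex≡m
... | tri> _ _ m<mex = ⊥-elim (m∉ (mex-covers xs m<mex))

mex-++-≢ : ∀ xs ys → (∀ {y} → y ∈ ys → y ≢ mex xs) → mex (xs ++ ys) ≡ mex xs
mex-++-≢ xs ys ys≢mex = mex-unique mex∉ (λ j<mex → ∈-++⁺ˡ (mex-covers xs j<mex))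
  where
  mex∉ : mex xs ∉ xs ++ ys
  mex∉ mex∈ with ∈-++⁻ xs mex∈
  ... | inj₁ mex∈xs = mex-∉ xs mex∈xs
  ... | inj₂ mex∈ys = ys≢mex mex∈ys refl

module _ {A : Set} (Opt : A → List A) where

  nimAcc-irrelevant : ∀ p (a b : Acc (OptRel Opt) p) → nimAcc Opt p a ≡ nimAcc Opt p b
  nimAcc-irrelevant p (acc rs) (acc rs′) =
    cong mex (mapWith∈-cong (Opt p) _ _ λ q∈ → nimAcc-irrelevant _ (rs q∈) (rs′ q∈))

  nimWF-unfold : (wf : WellFounded (OptRel Opt)) → ∀ p → nimWF Opt wf p ≡ mex (map (nimWF Opt wf) (Opt p))
  nimWF-unfold wf p = unfold (wf p)
    where
    unfold : (a : Acc (OptRel Opt) p) → nimAcc Opt p a ≡ mex (map (nimWF Opt wf) (Opt p))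
    unfold (acc rs) = cong mex (begin
      mapWith∈ (Opt p) (λ q∈ → nimAcc Opt _ (rs q∈))   ≡⟨ mapWith∈-cong (Opt p) _ _ (λ q∈ → nimAcc-irrelevant _ (rs q∈) (wf _)) ⟩
      mapWith∈ (Opt p) (λ {q} _ → nimWF Opt wf q)      ≡⟨ mapWith∈≗map (nimWF Opt wf) (Opt p) ⟩
      map (nimWF Opt wf) (Opt p)                       ∎)
      where open ≡-Reasoning

module _ {A B : Set} where

  map-unlessTerminal : ∀ {C : Set} (f : B → C) (xs : List A) ys → map f (unlessTerminal xs ys) ≡ unlessTerminal xs (map f ys)
  map-unlessTerminal f []      ys = refl
  map-unlessTerminal f (_ ∷ _) ys = refl

  unlessTerminal-[] : ∀ (xs : List A) → unlessTerminal xs ([] {A = B}) ≡ []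
  unlessTerminal-[] []      = refl
  unlessTerminal-[] (_ ∷ _) = refl

  ∈-unlessTerminal⁺ : ∀ {x : A} {xs} {y : B} {ys} → x ∈ xs → y ∈ ys → y ∈ unlessTerminal xs ys
  ∈-unlessTerminal⁺ {xs = _ ∷ _} _ y∈ = y∈

  ∈-unlessTerminal⁻ : ∀ (xs : List A) {y : B} {ys} → y ∈ unlessTerminal xs ys → ∃ (_∈ xs) × y ∈ ys
  ∈-unlessTerminal⁻ (x ∷ _) y∈ = (x , here refl) , y∈

module _ {k : ℕ} where

  DOpt-zero : ∀ {r : Fin (suc k)} → toℕ r ≡ 0 → DOpt r ≡ []
  DOpt-zero {zero} refl = refl

  DOpt-suc : ∀ {r : Fin (suc k)} {n} → toℕ r ≡ suc n → DOpt r ≡ [ pred r ]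
  DOpt-suc {suc _} _ = refl

  toℕ-pred : ∀ {r : Fin (suc k)} {n} → toℕ r ≡ suc n → toℕ (pred r) ≡ n
  toℕ-pred {suc t} r≡ = trans (toℕ-inject₁ t) (suc-injective r≡)

module Delayed (G : Gamegraph) (k : ℕ) where
  open Gamegraph G

  ν : Pos × Fin (suc k) → ℕ
  ν = nimDelayed G k

  -- nimDelayed is built on a well-foundedness proof that Defs keeps private;
  -- abstracting nimAcc makes it a rigid variable, so unification recovers that proof.
  ν-unfold : ∀ x → ν x ≡ mex (map ν (DelayedOpt G k x))
  ν-unfold x with nimAcc (DelayedOpt G k) | nimWF-unfold (DelayedOpt G k)
  ... | _ | unfold = unfold _ x

  optionValues : Pos → Fin (suc k) → List ℕ
  optionValues p r = map (λ q → ν (q , r)) (Opt p)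

  optionValues-cong : ∀ p {r s} → (∀ {q} → q ∈ Opt p → ν (q , r) ≡ ν (q , s)) → optionValues p r ≡ optionValues p s
  optionValues-cong p ν≡ = map-cong-local (All.tabulate ν≡)

  delayedValues-split : ∀ p r → map ν (DelayedOpt G k (p , r)) ≡
    optionValues p r ++ unlessTerminal (Opt p) (map (λ s → ν (p , s)) (DOpt r))
  delayedValues-split p r = begin
    map ν (map (λ q → q , r) (Opt p) ++ unlessTerminal (Opt p) (map (p ,_) (DOpt r)))
      ≡⟨ map-++ ν (map (λ q → q , r) (Opt p)) _ ⟩
    map ν (map (λ q → q , r) (Opt p)) ++ map ν (unlessTerminal (Opt p) (map (p ,_) (DOpt r)))
      ≡⟨ cong₂ _++_ (sym (map-∘ (Opt p))) (map-unlessTerminal ν (Opt p) _) ⟩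
    optionValues p r ++ unlessTerminal (Opt p) (map ν (map (p ,_) (DOpt r)))
      ≡⟨ cong (λ vs → optionValues p r ++ unlessTerminal (Opt p) vs) (sym (map-∘ (DOpt r))) ⟩
    optionValues p r ++ unlessTerminal (Opt p) (map (λ s → ν (p , s)) (DOpt r))
      ∎
    where open ≡-Reasoning

  ν-unfold-zero : ∀ p {r} → toℕ r ≡ 0 → ν (p , r) ≡ mex (optionValues p r)
  ν-unfold-zero p {r} r≡0 = begin
    ν (p , r)
      ≡⟨ ν-unfold (p , r) ⟩
    mex (map ν (DelayedOpt G k (p , r)))
      ≡⟨ cong mex (delayedValues-split p r) ⟩
    mex (optionValues p r ++ unlessTerminal (Opt p) (map (λ s → ν (p , s)) (DOpt r)))
      ≡⟨ cong (λ ss → mex (optionValues p r ++ unlessTerminal (Opt p) (map (λ s → ν (p , s)) ss))) (DOpt-zero r≡0) ⟩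
    mex (optionValues p r ++ unlessTerminal (Opt p) [])
      ≡⟨ cong (λ vs → mex (optionValues p r ++ vs)) (unlessTerminal-[] (Opt p)) ⟩
    mex (optionValues p r ++ [])
      ≡⟨ cong mex (++-identityʳ (optionValues p r)) ⟩
    mex (optionValues p r)
      ∎
    where open ≡-Reasoning

  ν-unfold-suc : ∀ p {r n} → toℕ r ≡ suc n →
    ν (p , r) ≡ mex (optionValues p r ++ unlessTerminal (Opt p) [ ν (p , pred r) ])
  ν-unfold-suc p {r} r≡ = begin
    ν (p , r)
      ≡⟨ ν-unfold (p , r) ⟩
    mex (map ν (DelayedOpt G k (p , r)))
      ≡⟨ cong mex (delayedValues-split p r) ⟩
    mex (optionValues p r ++ unlessTerminal (Opt p) (map (λ s → ν (p , s)) (DOpt r)))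
      ≡⟨ cong (λ ss → mex (optionValues p r ++ unlessTerminal (Opt p) (map (λ s → ν (p , s)) ss))) (DOpt-suc r≡) ⟩
    mex (optionValues p r ++ unlessTerminal (Opt p) [ ν (p , pred r) ])
      ∎
    where open ≡-Reasoning

  ν-zero : ∀ p → Acc (OptRel Opt) p → ν (p , zero) ≡ nim G p
  ν-zero p (acc rs) = begin
    ν (p , zero)                  ≡⟨ ν-unfold-zero p refl ⟩
    mex (optionValues p zero)     ≡⟨ cong mex (map-cong-local (All.tabulate λ q∈ → ν-zero _ (rs q∈))) ⟩
    mex (map (nim G) (Opt p))     ≡⟨ nimWF-unfold Opt acyclic p ⟨
    nim G p                       ∎
    where open ≡-Reasoning

  ν-≢-pred : ∀ {o p r n} → o ∈ Opt p → toℕ r ≡ suc n → ν (p , r) ≢ ν (p , pred r)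
  ν-≢-pred {p = p} {r} o∈ r≡ ν≡ = mex-∉ values (subst (_∈ values) (trans (sym ν≡) (ν-unfold-suc p r≡)) ν-pred∈)
    where
    values : List ℕ
    values = optionValues p r ++ unlessTerminal (Opt p) [ ν (p , pred r) ]
    ν-pred∈ : ν (p , pred r) ∈ values
    ν-pred∈ = ∈-++⁺ʳ (optionValues p r) (∈-unlessTerminal⁺ o∈ (here refl))

  ν-period : ∀ p → Acc (OptRel Opt) p → ∀ n (r : Fin (suc k)) → toℕ r ≡ 2 + n → ν (p , r) ≡ ν (p , pred (pred r))
  ν-period p (acc rs) zero r r≡ = begin
    ν (p , r)
      ≡⟨ ν-unfold-suc p r≡ ⟩
    mex (optionValues p r ++ unlessTerminal (Opt p) [ ν (p , r′) ])
      ≡⟨ cong (λ vs → mex (vs ++ unlessTerminal (Opt p) [ ν (p , r′) ]))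
              (optionValues-cong p λ q∈ → ν-period _ (rs q∈) zero r r≡) ⟩
    mex (optionValues p s ++ unlessTerminal (Opt p) [ ν (p , r′) ])
      ≡⟨ mex-++-≢ (optionValues p s) _ ν-r′≢mex ⟩
    mex (optionValues p s)
      ≡⟨ ν-unfold-zero p s≡ ⟨
    ν (p , s)
      ∎
    where
    open ≡-Reasoning
    r′ s : Fin (suc k)
    r′ = pred r
    s = pred r′
    r′≡ : toℕ r′ ≡ 1
    r′≡ = toℕ-pred r≡
    s≡ : toℕ s ≡ 0
    s≡ = toℕ-pred r′≡
    ν-r′≢mex : ∀ {y} → y ∈ unlessTerminal (Opt p) [ ν (p , r′) ] → y ≢ mex (optionValues p s)
    ν-r′≢mex y∈ with ∈-unlessTerminal⁻ (Opt p) y∈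
    ... | (_ , o∈) , here refl = λ ν≡mex → ν-≢-pred o∈ r′≡ (trans ν≡mex (sym (ν-unfold-zero p s≡)))
  ν-period p a@(acc rs) (suc n) r r≡ = begin
    ν (p , r)
      ≡⟨ ν-unfold-suc p r≡ ⟩
    mex (optionValues p r ++ unlessTerminal (Opt p) [ ν (p , r′) ])
      ≡⟨ cong₂ (λ vs v → mex (vs ++ unlessTerminal (Opt p) [ v ]))
               (optionValues-cong p λ q∈ → ν-period _ (rs q∈) (suc n) r r≡) (ν-period p a n r′ r′≡) ⟩
    mex (optionValues p s ++ unlessTerminal (Opt p) [ ν (p , pred s) ])
      ≡⟨ ν-unfold-suc p (toℕ-pred r′≡) ⟨
    ν (p , s)
      ∎
    where
    open ≡-Reasoning
    r′ s : Fin (suc k)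
    r′ = pred r
    s = pred r′
    r′≡ : toℕ r′ ≡ 2 + n
    r′≡ = toℕ-pred r≡

  ν-shift : ∀ p m (r s : Fin (suc k)) → toℕ r ≡ 2 * m + toℕ s → ν (p , r) ≡ ν (p , s)
  ν-shift p zero    r s r≡ = cong (λ t → ν (p , t)) (toℕ-injective r≡)
  ν-shift p (suc m) r s r≡ =
    trans (ν-period p (acyclic p) (2 * m + toℕ s) r r≡′) (ν-shift p m (pred (pred r)) s (toℕ-pred (toℕ-pred r≡′)))
    where
    r≡′ : toℕ r ≡ 2 + (2 * m + toℕ s)
    r≡′ = trans r≡ (cong (_+ toℕ s) (*-suc 2 m))

mainTheorem6 : (G : Gamegraph) (k : ℕ) (p : Gamegraph.Pos G) →
    ((r : ℕ) (h : 2 * r < suc k) →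
      nimDelayed G k (p , fromℕ< h) ≡ nimDelayed G k (p , zero))
    × (nimDelayed G k (p , zero) ≡ nim G p)
    × ((r : ℕ) (h : 2 * r + 1 < suc k) (h₁ : 1 < suc k) →
      nimDelayed G k (p , fromℕ< h) ≡ nimDelayed G k (p , fromℕ< h₁))
mainTheorem6 G k p =
  (λ r h → ν-shift p r (fromℕ< h) zero (trans (toℕ-fromℕ< h) (sym (+-identityʳ (2 * r))))) ,
  ν-zero p (acyclic p) ,
  (λ r h h₁ → ν-shift p r (fromℕ< h) (fromℕ< h₁) (trans (toℕ-fromℕ< h) (cong (2 * r +_) (sym (toℕ-fromℕ< h₁)))))
  where
  open Gamegraph G using (acyclic)
  open Delayed G k
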